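{- Let $D=\{X,Y\}$ be an orientation of a finite connected bipartite graph with partite sets $X,Y$ such that no vertex has in-degree zero. Then $D$ admits an independent dominating set, and $D$ has more than one independent dominating set.
   Context: In a digraph $D$, a set $S\subseteq V(D)$ is an independent dominating set if no arc of $D$ joins two vertices of $S$ and every vertex $u\in V(D)\setminus S$ has some $v\in S$ with $vu\in A(D)$. -}

module Defs where

open import Data.Nat using (ℕ)
open import Data.Bool using (Bool; true; false)
open import Data.Fin using (Fin)
open import Data.Fin.Subset using (Subset; _∈_; _∉_)
open import Data.Product using (_×_; ∃; ∃-syntax; Σ-syntax)
open import Data.Sum using (_⊎_)
open import Relation.Nullary using (¬_)
open import Relation.Binary.PropositionalEquality using (_≡_; _≢_)

record Digraph (n : ℕ) : Set where
  field
    arc : Fin n → Fin n → Bool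

open Digraph public

Arc : ∀ {n} → Digraph n → Fin n → Fin n → Set
Arc D u v = arc D u v ≡ true

-- D is an orientation of a (simple) graph: no loops, no pair of opposite arcs
-- (the u ≡ v case excludes loops).
IsOrientation : ∀ {n} → Digraph n → Set
IsOrientation D = ∀ u v → ¬ (Arc D u v × Arc D v u)

Adj : ∀ {n} → Digraph n → Fin n → Fin n → Set
Adj D u v = Arc D u v ⊎ Arc D v u

data Reach {n : ℕ} (D : Digraph n) : Fin n → Fin n → Set where
  here : ∀ {u} → Reach D u u
  step : ∀ {u v w} → Adj D u v → Reach D v w → Reach D u w

-- underlying graph is connected (and nonempty, as usual for connected graphs)
IsConnected : ∀ {n} → Digraph n → Set
IsConnected {n} D = Fin n × (∀ u v → Reach D u v)

-- underlying graph is bipartite with partite sets X = {v | side v ≡ true},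
-- Y = {v | side v ≡ false}: every arc joins X and Y.
IsBipartition : ∀ {n} → Digraph n → (Fin n → Bool) → Set
IsBipartition D side = ∀ u v → Arc D u v → side u ≢ side v

IsIndependentDominating : ∀ {n} → Digraph n → Subset n → Set
IsIndependentDominating {n} D S =
  (∀ u v → u ∈ S → v ∈ S → ¬ Arc D u v) ×
  (∀ u → u ∉ S → ∃[ v ] (v ∈ S × Arc D v u))

module Submission where

-- Call a vertex set S a *partite set* of D when every arc of D
-- has exactly one end in S, i.e. both S and its complement ∁ S are
-- independent.  In a digraph without sources (every vertex has an
-- in-neighbour) a partite set is an independent dominating set: it is
-- independent by definition, and the in-neighbour of a vertex outside S must
-- lie in S, since otherwise the arc would join two vertices of ∁ S.
-- Partite sets are closed under complement, and the class X of a
-- bipartition is a partite set; so X and Y = ∁ X are both independent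
-- dominating sets.  Finally, on a nonempty vertex set no subset equals its
-- complement, and a connected graph is nonempty, so X ≢ Y.

open import Defs
open import Data.Nat using (ℕ)
open import Data.Bool using (Bool; true; false)
open import Data.Fin using (Fin)
open import Data.Fin.Subset using (Subset; _∈_; _∉_; ∁)
open import Data.Fin.Subset.Properties
  using (_∈?_; x∈p⇒x∉∁p; x∈∁p⇒x∉p; x∉p⇒x∈∁p; x∉∁p⇒x∈p)
open import Data.Product using (_×_; ∃; ∃-syntax; _,_; proj₁)
open import Data.Vec using (tabulate; lookup)
open import Data.Vec.Properties using ([]=⇒lookup; lookup⇒[]=; lookup∘tabulate)
open import Relation.Nullary using (¬_; yes; no; contradiction)
open import Relation.Binary.PropositionalEquality
  using (_≡_; _≢_; refl; sym; trans; subst)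

IsPartiteSet : ∀ {n} → Digraph n → Subset n → Set
IsPartiteSet {n} D S =
  (∀ u v → Arc D u v → u ∈ S → v ∉ S) ×
  (∀ u v → Arc D u v → u ∉ S → v ∈ S)

partite⇒independentDominating : ∀ {n} (D : Digraph n) (S : Subset n) →
  (∀ v → ∃[ u ] Arc D u v) → IsPartiteSet D S → IsIndependentDominating D S
partite⇒independentDominating D S inNeighbour (outOfS , intoS) =
  independent , dominating
  where
  independent : ∀ u v → u ∈ S → v ∈ S → ¬ Arc D u v
  independent u v u∈S v∈S uv = outOfS u v uv u∈S v∈S

  -- the in-neighbour w of u ∉ S lies in S, else the arc wu would force u ∈ S
  dominating : ∀ u → u ∉ S → ∃[ w ] (w ∈ S × Arc D w u)
  dominating u u∉S with inNeighbour u
  ... | w , wu with w ∈? S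
  ...   | yes w∈S = w , w∈S , wu
  ...   | no  w∉S = w , contradiction (intoS w u wu w∉S) u∉S , wu

∁-partite : ∀ {n} (D : Digraph n) (S : Subset n) →
  IsPartiteSet D S → IsPartiteSet D (∁ S)
∁-partite D S (outOfS , intoS) = outOfCS , intoCS
  where
  outOfCS : ∀ u v → Arc D u v → u ∈ ∁ S → v ∉ ∁ S
  outOfCS u v uv u∈∁S = x∈p⇒x∉∁p (intoS u v uv (x∈∁p⇒x∉p u∈∁S))

  intoCS : ∀ u v → Arc D u v → u ∉ ∁ S → v ∈ ∁ S
  intoCS u v uv u∉∁S = x∉p⇒x∈∁p (outOfS u v uv (x∉∁p⇒x∈p u∉∁S))

toSubset : ∀ {n} → (Fin n → Bool) → Subset n
toSubset = tabulate

∈toSubset⇒ : ∀ {n} (g : Fin n → Bool) x → x ∈ toSubset g → g x ≡ true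
∈toSubset⇒ g x x∈ = trans (sym (lookup∘tabulate g x)) ([]=⇒lookup x∈)

toSubset-∈ : ∀ {n} (g : Fin n → Bool) x → g x ≡ true → x ∈ toSubset g
toSubset-∈ g x gx = lookup⇒[]= x (tabulate g) (trans (lookup∘tabulate g x) gx)

bipartitionClass-partite : ∀ {n} (D : Digraph n) (side : Fin n → Bool) →
  IsBipartition D side → IsPartiteSet D (toSubset side)
bipartitionClass-partite D side bip = outOfX , intoX
  where
  sideOf : ∀ x → x ∉ toSubset side → side x ≡ false
  sideOf x x∉X with side x in eq
  ... | true  = contradiction (toSubset-∈ side x eq) x∉X
  ... | false = refl

  outOfX : ∀ u v → Arc D u v → u ∈ toSubset side → v ∉ toSubset side
  outOfX u v uv u∈X v∈X =
    bip u v uv (trans (∈toSubset⇒ side u u∈X) (sym (∈toSubset⇒ side v v∈X)))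

  intoX : ∀ u v → Arc D u v → u ∉ toSubset side → v ∈ toSubset side
  intoX u v uv u∉X with side v in eq
  ... | true  = toSubset-∈ side v eq
  ... | false = contradiction (trans (sideOf u u∉X) (sym eq)) (bip u v uv)

≢∁ : ∀ {n} → Fin n → (S : Subset n) → S ≢ ∁ S
≢∁ x S S≡∁S with x ∈? S
... | yes x∈S = x∈p⇒x∉∁p x∈S (subst (x ∈_) S≡∁S x∈S)
... | no  x∉S = x∉S (subst (x ∈_) (sym S≡∁S) (x∉p⇒x∈∁p x∉S))

mainTheorem14 : (n : ℕ) (D : Digraph n) (side : Fin n → Bool) →
    IsOrientation D → IsBipartition D side → IsConnected D →
    (∀ v → ∃[ u ] Arc D u v) →
    (∃[ S ] IsIndependentDominating D S) ×
    (∃[ S ] ∃[ T ] (IsIndependentDominating D S × IsIndependentDominating D T × S ≢ T))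
mainTheorem14 n D side _ bip conn inNeighbour =
  (X , X-ids) , (X , ∁ X , X-ids , Y-ids , ≢∁ (proj₁ conn) X)
  where
  X : Subset n
  X = toSubset side

  X-partite : IsPartiteSet D X
  X-partite = bipartitionClass-partite D side bip

  X-ids : IsIndependentDominating D X
  X-ids = partite⇒independentDominating D X inNeighbour X-partite

  Y-ids : IsIndependentDominating D (∁ X)
  Y-ids = partite⇒independentDominating D (∁ X) inNeighbour (∁-partite D X X-partite)
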